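{- Let $\delta>0$ and integers $d,k\ge 1$. Let $n\ge n_0(\delta,d,k):=20M_d(\delta,k)/\delta$. Let $G$ be any $d$-bounded $n$-vertex graph and let $H$ be a $(\delta,k)$-blow-up graph of $G$. Then $\|\mathrm{freq}_k(G)-\mathrm{freq}_k(H)\|_1<1.1\delta$.
   Context: A graph is $d$-bounded if its maximum degree is at most $d$. The $k$-disc of a vertex $v$ in $G$ is the subgraph induced by the vertices at distance at most $k$ from $v$, rooted at $v$ (isomorphism is root-preserving). $\mathrm{freq}_k(G)$ is the vector indexed by isomorphism types $\Delta$ of $k$-discs of $d$-bounded graphs whose $\Delta$-entry is the fraction of vertices of $G$ whose $k$-disc is isomorphic to $\Delta$; $\|\cdot\|_1$ is the $\ell_1$-norm. By a result of Alon, there is a function $M_d(\delta,k)$ such that every $d$-bounded graph $G$ has a $d$-bounded graph $H_0$ on at most $M_d(\delta,k)$ vertices with $\|\mathrm{freq}_k(G)-\mathrm{freq}_k(H_0)\|_1<\delta$; such $H_0$ is called a $(\delta,k)$-disc frequency preserver of $G$; fix such a function $M_d$. For an $n$-vertex $d$-bounded graph $G$ and a $(\delta,k)$-disc frequency preserver $H_0$ of $G$ with $h\le M_d(\delta,k)$ vertices, the $n$-vertex graph consisting of $\lfloor n/h\rfloor$ disjoint copies of $H_0$ together with $n-h\lfloor n/h\rfloor$ isolated vertices is called a $(\delta,k)$-blow-up graph of $G$.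
   Formalization: The parameter δ ranges over the positive rationals, and the fixed function $M_d$ takes rational δ, with Alon's bound assumed for rational δ only. -}

module Defs where

open import Data.Bool using (Bool; true; false; _∧_; _∨_; not; _xor_; if_then_else_; T)
open import Data.Nat using (ℕ; zero; suc; _≤_; _≡ᵇ_; _<ᵇ_)
import Data.Nat as ℕ
open import Data.Nat.DivMod using (_mod_)
open import Data.Fin using (Fin; zero; suc; toℕ)
import Data.Fin as Fin
open import Data.List using (List; []; _∷_; map; concatMap; allFin; foldr; [_])
open import Data.Bool.ListAction using (any; all)
open import Data.Integer using (+_)
open import Data.Rational using (ℚ; 0ℚ; _+_; _-_; ∣_∣; _<_; _/_)
open import Data.Product using (Σ; _×_)
open import Relation.Nullary.Decidable using (⌊_⌋)

Graph : ℕ → Set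
Graph n = Fin n → Fin n → Bool

IsSimple : ∀ {n} → Graph n → Set
IsSimple {n} G = (∀ i j → G i j ≡' G j i) × (∀ i → G i i ≡' false)
  where
  open import Relation.Binary.PropositionalEquality renaming (_≡_ to _≡'_)

_==F_ : ∀ {n} → Fin n → Fin n → Bool
x ==F y = ⌊ x Fin.≟ y ⌋

_==B_ : Bool → Bool → Bool
a ==B b = not (a xor b)

countB : ∀ {A : Set} → (A → Bool) → List A → ℕ
countB p = foldr (λ x acc → if p x then suc acc else acc) 0

deg : ∀ {n} → Graph n → Fin n → ℕ
deg {n} G v = countB (G v) (allFin n)

Bounded : ℕ → ∀ {n} → Graph n → Set
Bounded d G = ∀ v → deg G v ≤ d

reach : ∀ {n} → Graph n → ℕ → Fin n → Fin n → Bool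
reach G zero v u = v ==F u
reach {n} G (suc k) v u = reach G k v u ∨ any (λ w → G v w ∧ reach G k w u) (allFin n)

allFuns : ∀ n m → List (Fin n → Fin m)
allFuns zero m = [ (λ ()) ]
allFuns (suc n) m =
  concatMap (λ b → map (λ f → λ { zero → b ; (suc i) → f i }) (allFuns n m)) (allFin m)

-- f restricts to a root-preserving isomorphism from the k-disc of v in G
-- (induced subgraph on the ball of radius k around v) onto the k-disc of w in H
IsDiscIso : ∀ {n m} → ℕ → Graph n → Fin n → Graph m → Fin m → (Fin n → Fin m) → Bool
IsDiscIso {n} {m} k G v H w f =
  (f v ==F w)
  ∧ all (λ x → not (inBG x) ∨ reach H k w (f x)) (allFin n)
  ∧ all (λ x → all (λ y → not (inBG x ∧ inBG y) ∨ (x ==F y) ∨ not (f x ==F f y)) (allFin n)) (allFin n)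
  ∧ all (λ u → not (reach H k w u) ∨ any (λ x → inBG x ∧ (f x ==F u)) (allFin n)) (allFin m)
  ∧ all (λ x → all (λ y → not (inBG x ∧ inBG y) ∨ (G x y ==B H (f x) (f y))) (allFin n)) (allFin n)
  where
  inBG : Fin n → Bool
  inBG x = reach G k v x

discIso : ∀ {n m} → ℕ → Graph n → Fin n → Graph m → Fin m → Bool
discIso {n} {m} k G v H w = any (IsDiscIso k G v H w) (allFuns n m)

cnt : ∀ {n m} → ℕ → Graph n → Fin n → Graph m → ℕ
cnt {m = m} k G v H = countB (discIso k G v H) (allFin m)

-- a / n as a rational (convention: 0 when n = 0, i.e. the empty graph has
-- the zero frequency vector)
frac : ℕ → ℕ → ℚ
frac a zero = 0ℚ
frac a (suc n) = (+ a) / suc n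

sumℚ : ∀ {A : Set} → (A → ℚ) → List A → ℚ
sumℚ f = foldr (λ x acc → f x + acc) 0ℚ

firstIn : ∀ {n} → ℕ → Graph n → Fin n → Bool
firstIn {n} k G v = not (any (λ x → (toℕ x <ᵇ toℕ v) ∧ discIso k G x G v) (allFin n))

-- ‖freq_k(G) − freq_k(H)‖₁ : the sum over isomorphism types Δ of k-discs of
-- |freq_Δ(G) − freq_Δ(H)|. Types occurring in neither graph contribute 0;
-- every other type is counted once, via its first representative in G, or
-- (if it does not occur in G) via its first representative in H.
dist1 : ∀ {n m} → ℕ → Graph n → Graph m → ℚ
dist1 {n} {m} k G H =
  sumℚ (λ v → if firstIn k G v
                then ∣ frac (cnt k G v G) n - frac (cnt k G v H) m ∣
                else 0ℚ) (allFin n)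
  + sumℚ (λ u → if firstIn k H u ∧ not (any (λ x → discIso k G x H u) (allFin n))
                then frac (cnt k H u H) m
                else 0ℚ) (allFin m)

IsPreserver : ℕ → ℚ → ℕ → ∀ {n h} → Graph n → Graph h → Set
IsPreserver d δ k G H₀ = IsSimple H₀ × Bounded d H₀ × (dist1 k G H₀ < δ)

-- Alon's theorem for the fixed bound function M = M_d : every d-bounded graph
-- has a (δ,k)-disc frequency preserver on at most M δ k vertices.
AlonBound : ℕ → (ℚ → ℕ → ℕ) → Set
AlonBound d M = ∀ (δ : ℚ) → 0ℚ < δ → ∀ (k n : ℕ) (G : Graph n) → IsSimple G → Bounded d G →
  Σ ℕ λ h → Σ (Graph h) λ H₀ → (h ≤ M δ k) × IsPreserver d δ k G H₀

-- the n-vertex graph: ⌊n/h⌋ disjoint copies of H₀ (copy c on vertices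
-- c·h, …, c·h+h−1) plus n − h⌊n/h⌋ isolated vertices (the last ones).
blowUp : (n h : ℕ) → Graph h → Graph n
blowUp n zero H₀ i j = false
blowUp n (suc h) H₀ i j =
  ((toℕ i ℕ./ suc h) ≡ᵇ (toℕ j ℕ./ suc h))
  ∧ ((toℕ i ℕ./ suc h) <ᵇ (n ℕ./ suc h))
  ∧ H₀ (toℕ i mod suc h) (toℕ j mod suc h)

-- The blow-up H consists of q = ⌊n/h⌋ disjoint copies of H₀ and r = n mod h < h
-- isolated leftover vertices. A vertex of a copy has the same k-disc as the
-- corresponding vertex of H₀, so a disc type occurring c times in H₀ occurs
-- qc + ρ times in H, where ρ counts the leftover vertices of that type. As
-- n = qh + r, the frequencies differ by |(qc + ρ)/n − c/h| ≤ rc/(hn) + ρ/n.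
-- Summed over all disc types, the c add up to at most h, and the ρ together
-- with the leftover vertices of types absent from G add up to at most r. Hence
-- ‖freq_k(G) − freq_k(H)‖₁ ≤ ‖freq_k(G) − freq_k(H₀)‖₁ + 2r/n < δ + 2M/n ≤ 1.1δ.
module Submission where

open import Defs
open import Data.Bool using (Bool; true; false; _∧_; _∨_; not; T; if_then_else_)
open import Data.Bool.Properties using (T-∧; T-∨; T-≡; T-not-≡; T?)
open import Data.Bool.ListAction using (any; all; or)
open import Data.Nat using (ℕ; zero; suc; _≤_; _<ᵇ_; z≤n; s≤s; NonZero)
import Data.Nat as ℕ
import Data.Nat.Properties as ℕP
open import Data.Fin using (Fin; zero; suc; toℕ; fromℕ<; cast; _↑ˡ_; _↑ʳ_)
import Data.Fin as Fin
import Data.Fin.Properties as FinP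
open import Data.Fin.Induction using (<-wellFounded)
open import Data.Nat.DivMod
  using ( _mod_; m≡m%n+[m/n]*n; m/n*n≤m; +-distrib-/-∣ʳ; m<n⇒m/n≡0; m*n/n≡m; m<n*o⇒m/o<n
        ; [m+kn]%n≡m%n; [m+n]%n≡m%n; m<n⇒m%n≡m; m%n<n)
open import Data.Nat.Divisibility using (divides-refl)
open import Data.List using ([]; _∷_; allFin; tabulate)
open import Data.List.Properties using (map-cong)
open import Data.List.Relation.Unary.Any using (Any; here; satisfied)
import Data.List.Relation.Unary.Any as Any
import Data.List.Relation.Unary.Any.Properties as Anyₚ
import Data.List.Relation.Unary.All as All
import Data.List.Relation.Unary.All.Properties as Allₚ
open import Data.List.Membership.Propositional using (lose)
open import Data.List.Membership.Propositional.Properties using (∈-allFin)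
open import Data.Product using (∃; _×_; _,_; proj₁; proj₂)
open import Data.Sum using (_⊎_; inj₁; inj₂)
open import Data.Empty using (⊥-elim)
open import Function using (_∘_; id; _⇔_; Equivalence; mk⇔)
open import Induction.WellFounded using (Acc; acc)
open import Relation.Nullary using (¬_; Dec; yes; no)
open import Relation.Binary.Definitions using (tri<; tri≈; tri>)
open import Relation.Nullary.Decidable using (toWitness; fromWitness)
open import Relation.Binary.PropositionalEquality
  using (_≡_; refl; sym; trans; cong; cong₂; subst; subst₂; _≗_; module ≡-Reasoning)

open import Algebra.Properties.Semiring.Sum ℕP.+-*-semiring
  using (sum; sum-syntax; sum-cong-≗; sum-replicate-zero; ∑-comm; ∑-distrib-+; *-distribˡ-sum)

open import Data.Integer using (+_)
import Data.Integer as ℤ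
import Data.Integer.Properties as ℤP
open import Data.Rational using (ℚ; 0ℚ; 1ℚ; ∣_∣; toℚᵘ; _<_; _*_; _/_)
import Data.Rational as ℚ
import Data.Rational.Properties as ℚP
open import Data.Rational.Unnormalised using (mkℚᵘ; *≤*; *<*) renaming (_≃_ to _≃ᵘ_)
import Data.Rational.Unnormalised as ℚᵘ
import Data.Rational.Unnormalised.Properties as ℚᵘP

open import Data.Nat.Tactic.RingSolver using (solve-∀)
open import Data.Rational.Solver using (module +-*-Solver)
open +-*-Solver using (solve; con; _:+_; _:-_; _:*_; _:=_)

open Equivalence using (to; from)

module _ {n : ℕ} (p : Fin n → Bool) where

  any-allFin⁺ : ∀ i → T (p i) → T (any p (allFin n))
  any-allFin⁺ i pᵢ = Anyₚ.any⁺ p (lose (∈-allFin i) pᵢ)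

  any-allFin⁻ : T (any p (allFin n)) → ∃ λ i → T (p i)
  any-allFin⁻ = satisfied ∘ Anyₚ.any⁻ p (allFin n)

  all-allFin⁺ : (∀ i → T (p i)) → T (all p (allFin n))
  all-allFin⁺ pᵢ = Allₚ.all⁻ p (Allₚ.tabulate⁺ pᵢ)

  all-allFin⁻ : T (all p (allFin n)) → ∀ i → T (p i)
  all-allFin⁻ t i = All.lookup (Allₚ.all⁺ p (allFin n) t) (∈-allFin i)

module _ {n : ℕ} (p : Fin n → Fin n → Bool) where

  all²-allFin⁺ : (∀ i j → T (p i j)) → T (all (λ i → all (p i) (allFin n)) (allFin n))
  all²-allFin⁺ pᵢⱼ = all-allFin⁺ _ λ i → all-allFin⁺ (p i) (pᵢⱼ i)

  all²-allFin⁻ : T (all (λ i → all (p i) (allFin n)) (allFin n)) → ∀ i j → T (p i j)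
  all²-allFin⁻ t i = all-allFin⁻ (p i) (all-allFin⁻ _ t i)

T-not-∨ : ∀ {a b} → T (not a ∨ b) ⇔ (T a → T b)
T-not-∨ {true}  = mk⇔ (λ t _ → t) (λ f → f _)
T-not-∨ {false} = mk⇔ (λ _ ()) (λ _ → _)

T-injective : ∀ {a b} → (T a → T b) → (T b → T a) → a ≡ b
T-injective {true}  {true}  _ _ = refl
T-injective {false} {false} _ _ = refl
T-injective {true}  {false} a⇒b _ = ⊥-elim (a⇒b _)
T-injective {false} {true}  _ b⇒a = ⊥-elim (b⇒a _)

T-==F : ∀ {n} {x y : Fin n} → T (x ==F y) ⇔ x ≡ y
T-==F = mk⇔ toWitness fromWitness

T-==B : ∀ {a b} → T (a ==B b) ⇔ a ≡ b
T-==B {true}  {true}  = mk⇔ (λ _ → refl) (λ _ → _)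
T-==B {false} {false} = mk⇔ (λ _ → refl) (λ _ → _)
T-==B {true}  {false} = mk⇔ (λ ()) (λ ())
T-==B {false} {true}  = mk⇔ (λ ()) (λ ())

-- Rooted isomorphisms of discs

InBall : ∀ {n} → Graph n → ℕ → Fin n → Fin n → Set
InBall X k x a = T (reach X k x a)

reach-refl : ∀ {n} (X : Graph n) k v → InBall X k v v
reach-refl X zero v = from T-==F refl
reach-refl X (suc k) v = from T-∨ (inj₁ (reach-refl X k v))

record DiscIso (k : ℕ) {n m} (X : Graph n) (x : Fin n) (Y : Graph m) (y : Fin m)
               (f : Fin n → Fin m) : Set where
  field
    root  : f x ≡ y
    into  : ∀ {a} → InBall X k x a → InBall Y k y (f a)
    inj   : ∀ {a b} → InBall X k x a → InBall X k x b → f a ≡ f b → a ≡ b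
    onto  : ∀ {u} → InBall Y k y u → ∃ λ a → InBall X k x a × f a ≡ u
    edge  : ∀ {a b} → InBall X k x a → InBall X k x b → X a b ≡ Y (f a) (f b)

T-∧⁵ : ∀ {a b c d e} → T (a ∧ b ∧ c ∧ d ∧ e) ⇔ (T a × T b × T c × T d × T e)
T-∧⁵ {a} {b} {c} {d} {e} = mk⇔ split join
  where
  split : T (a ∧ b ∧ c ∧ d ∧ e) → T a × T b × T c × T d × T e
  split t₁ = let ta , t₂ = to (T-∧ {a}) t₁ ; tb , t₃ = to (T-∧ {b}) t₂
                 tc , t₄ = to (T-∧ {c}) t₃ ; td , te = to (T-∧ {d}) t₄
             in ta , tb , tc , td , te
  join : T a × T b × T c × T d × T e → T (a ∧ b ∧ c ∧ d ∧ e)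
  join (ta , tb , tc , td , te) =
    from (T-∧ {a}) (ta , from (T-∧ {b}) (tb , from (T-∧ {c}) (tc , from (T-∧ {d}) (td , te))))

module _ (k : ℕ) {n m} (X : Graph n) (x : Fin n) (Y : Graph m) (y : Fin m) (f : Fin n → Fin m) where

  private
    intoAt : Fin n → Bool
    ontoAt : Fin m → Bool
    preimageAt : Fin m → Fin n → Bool
    injAt edgeAt : Fin n → Fin n → Bool
    intoAt a = not (reach X k x a) ∨ reach Y k y (f a)
    injAt a b = not (reach X k x a ∧ reach X k x b) ∨ (a ==F b) ∨ not (f a ==F f b)
    preimageAt u a = reach X k x a ∧ (f a ==F u)
    ontoAt u = not (reach Y k y u) ∨ any (preimageAt u) (allFin n)
    edgeAt a b = not (reach X k x a ∧ reach X k x b) ∨ (X a b ==B Y (f a) (f b))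

    rootOK intoOK injOK ontoOK edgeOK : Bool
    rootOK = f x ==F y
    intoOK = all intoAt (allFin n)
    injOK  = all (λ a → all (injAt a) (allFin n)) (allFin n)
    ontoOK = all ontoAt (allFin m)
    edgeOK = all (λ a → all (edgeAt a) (allFin n)) (allFin n)

    T-IsDiscIso : T (IsDiscIso k X x Y y f) ⇔ (T rootOK × T intoOK × T injOK × T ontoOK × T edgeOK)
    T-IsDiscIso = T-∧⁵

  IsDiscIso⇒DiscIso : T (IsDiscIso k X x Y y f) → DiscIso k X x Y y f
  IsDiscIso⇒DiscIso t with to T-IsDiscIso t
  ... | t-root , t-into , t-inj , t-onto , t-edge = record
    { root = to T-==F t-root
    ; into = λ {a} → to T-not-∨ (all-allFin⁻ intoAt t-into a)
    ; inj  = λ {a} {b} ra rb → inj′ (to T-∨ (to T-not-∨ (all²-allFin⁻ injAt t-inj a b) (from T-∧ (ra , rb))))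
    ; onto = λ {u} ru → onto′ (any-allFin⁻ (preimageAt u) (to T-not-∨ (all-allFin⁻ ontoAt t-onto u) ru))
    ; edge = λ {a} {b} ra rb → to T-==B (to T-not-∨ (all²-allFin⁻ edgeAt t-edge a b) (from T-∧ (ra , rb)))
    }
    where
    inj′ : ∀ {a b} → T (a ==F b) ⊎ T (not (f a ==F f b)) → f a ≡ f b → a ≡ b
    inj′ (inj₁ a≡b) _ = to T-==F a≡b
    inj′ (inj₂ fa≢fb) fa≡fb = ⊥-elim (subst T (to T-not-≡ fa≢fb) (from T-==F fa≡fb))
    onto′ : ∀ {u} → (∃ λ a → T (preimageAt u a)) → ∃ λ a → InBall X k x a × f a ≡ u
    onto′ (a , t) = a , proj₁ (to T-∧ t) , to T-==F (proj₂ (to T-∧ t))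

  DiscIso⇒IsDiscIso : DiscIso k X x Y y f → T (IsDiscIso k X x Y y f)
  DiscIso⇒IsDiscIso I = from T-IsDiscIso
    ( from T-==F root
    , all-allFin⁺ intoAt (λ a → from T-not-∨ into)
    , all²-allFin⁺ injAt (λ a b → from T-not-∨ λ t → injective-at a b (to T-∧ t))
    , all-allFin⁺ ontoAt (λ u → from T-not-∨ (preimage-at u))
    , all²-allFin⁺ edgeAt (λ a b → from T-not-∨ λ t → from T-==B (edge (proj₁ (to T-∧ t)) (proj₂ (to T-∧ t))))
    )
    where
    open DiscIso I
    injective-at : ∀ a b → InBall X k x a × InBall X k x b → T ((a ==F b) ∨ not (f a ==F f b))
    injective-at a b (ra , rb) with a Fin.≟ b
    ... | yes _ = _
    ... | no a≢b with f a Fin.≟ f b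
    ...   | yes fa≡fb = ⊥-elim (a≢b (inj ra rb fa≡fb))
    ...   | no _ = _
    preimage-at : ∀ u → InBall Y k y u → T (any (preimageAt u) (allFin n))
    preimage-at u ru = let a , ra , fa≡u = onto ru in any-allFin⁺ (preimageAt u) a (from T-∧ (ra , from T-==F fa≡u))

module _ {k n m : ℕ} {X : Graph n} {x : Fin n} {Y : Graph m} {y : Fin m} where

  DiscIso-resp-≗ : ∀ {f g} → f ≗ g → DiscIso k X x Y y f → DiscIso k X x Y y g
  DiscIso-resp-≗ {f} {g} f≗g I = record
    { root = trans (sym (f≗g x)) root
    ; into = λ {a} ra → subst (InBall Y k y) (f≗g a) (into ra)
    ; inj  = λ {a} {b} ra rb ga≡gb → inj ra rb (trans (f≗g a) (trans ga≡gb (sym (f≗g b))))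
    ; onto = λ ru → let a , ra , fa≡u = onto ru in a , ra , trans (sym (f≗g a)) fa≡u
    ; edge = λ {a} {b} ra rb → trans (edge ra rb) (cong₂ Y (f≗g a) (f≗g b))
    }
    where open DiscIso I

  DiscIso-sym : ∀ {f} → DiscIso k X x Y y f → ∃ (DiscIso k Y y X x)
  DiscIso-sym {f} I = g , record
    { root = inj (proj₁ (g-spec y∈B)) (reach-refl X k x) (trans (proj₂ (g-spec y∈B)) (sym root))
    ; into = proj₁ ∘ g-spec
    ; inj  = λ {u} {v} ru rv gu≡gv → trans (sym (proj₂ (g-spec ru))) (trans (cong f gu≡gv) (proj₂ (g-spec rv)))
    ; onto = λ {a} ra → f a , into ra , inj (proj₁ (g-spec (into ra))) ra (proj₂ (g-spec (into ra)))
    ; edge = λ {u} {v} ru rv → trans (cong₂ Y (sym (proj₂ (g-spec ru))) (sym (proj₂ (g-spec rv))))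
                                      (sym (edge (proj₁ (g-spec ru)) (proj₁ (g-spec rv))))
    }
    where
    open DiscIso I
    y∈B : InBall Y k y y
    y∈B = reach-refl Y k y
    Preimage : Fin m → Fin n → Set
    Preimage u a = T (reach X k x a ∧ (f a ==F u))
    search : ∀ u → Dec (∃ (Preimage u))
    search u = FinP.any? (λ a → T? (reach X k x a ∧ (f a ==F u)))
    choose : ∀ u → Dec (∃ (Preimage u)) → Fin n
    choose u (yes (a , _)) = a
    choose u (no _) = x
    g : Fin m → Fin n
    g u = choose u (search u)
    g-spec : ∀ {u} → InBall Y k y u → InBall X k x (g u) × f (g u) ≡ u
    g-spec {u} ru = spec (search u)
      where
      spec : (d : Dec (∃ (Preimage u))) → InBall X k x (choose u d) × f (choose u d) ≡ u
      spec (yes (a , t)) = proj₁ (to T-∧ t) , to T-==F (proj₂ (to T-∧ t))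
      spec (no ∄) = let a , ra , fa≡u = onto ru in ⊥-elim (∄ (a , from T-∧ (ra , from T-==F fa≡u)))

DiscIso-refl : ∀ k {n} (X : Graph n) x → DiscIso k X x X x id
DiscIso-refl k X x = record
  { root = refl ; into = id ; inj = λ _ _ → id ; onto = λ {u} ru → u , ru , refl ; edge = λ _ _ → refl }

DiscIso-trans : ∀ {k n m l} {X : Graph n} {x} {Y : Graph m} {y} {Z : Graph l} {z} {f g} →
  DiscIso k X x Y y f → DiscIso k Y y Z z g → DiscIso k X x Z z (g ∘ f)
DiscIso-trans {g = g} I J = record
  { root = trans (cong g I.root) J.root
  ; into = J.into ∘ I.into
  ; inj  = λ ra rb → I.inj ra rb ∘ J.inj (I.into ra) (I.into rb)
  ; onto = λ rw → let b , rb , gb≡w = J.onto rw ; a , ra , fa≡b = I.onto rb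
                  in a , ra , trans (cong g fa≡b) gb≡w
  ; edge = λ ra rb → trans (I.edge ra rb) (J.edge (I.into ra) (I.into rb))
  }
  where
  module I = DiscIso I
  module J = DiscIso J

allFuns-complete : ∀ n m (f : Fin n → Fin m) → Any (_≗ f) (allFuns n m)
allFuns-complete zero    m f = here (λ ())
allFuns-complete (suc n) m f =
  Anyₚ.concatMap⁺ _ (lose (∈-allFin (f zero))
    (Anyₚ.map⁺ (Any.map (λ g≗f → λ { zero → refl ; (suc i) → g≗f i }) (allFuns-complete n m (f ∘ suc)))))

module _ (k : ℕ) {n m} (X : Graph n) (x : Fin n) (Y : Graph m) (y : Fin m) where

  discIso⁺ : ∀ {f} → DiscIso k X x Y y f → T (discIso k X x Y y)
  discIso⁺ I = Anyₚ.any⁺ _ (Any.map (λ g≗f → DiscIso⇒IsDiscIso k X x Y y _ (DiscIso-resp-≗ (sym ∘ g≗f) I))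
                                     (allFuns-complete n m _))

  discIso⁻ : T (discIso k X x Y y) → ∃ (DiscIso k X x Y y)
  discIso⁻ t = let f , t-f = satisfied (Anyₚ.any⁻ _ (allFuns n m) t) in f , IsDiscIso⇒DiscIso k X x Y y f t-f

discIso-refl : ∀ k {n} (X : Graph n) x → T (discIso k X x X x)
discIso-refl k X x = discIso⁺ k X x X x (DiscIso-refl k X x)

discIso-sym : ∀ k {n m} (X : Graph n) x (Y : Graph m) y → T (discIso k X x Y y) → T (discIso k Y y X x)
discIso-sym k X x Y y t = discIso⁺ k Y y X x (proj₂ (DiscIso-sym (proj₂ (discIso⁻ k X x Y y t))))

discIso-trans : ∀ k {n m l} (X : Graph n) x (Y : Graph m) y (Z : Graph l) z →
  T (discIso k X x Y y) → T (discIso k Y y Z z) → T (discIso k X x Z z)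
discIso-trans k X x Y y Z z s t =
  discIso⁺ k X x Z z (DiscIso-trans (proj₂ (discIso⁻ k X x Y y s)) (proj₂ (discIso⁻ k Y y Z z t)))

module _ (k : ℕ) {m} (X : Graph m) where

  private
    earlierTwin : Fin m → Fin m → Bool
    earlierTwin v x = (toℕ x <ᵇ toℕ v) ∧ discIso k X x X v

  firstIn-minimal : ∀ {x v} → T (firstIn k X v) → toℕ x ℕ.< toℕ v → ¬ T (discIso k X x X v)
  firstIn-minimal {x} {v} first x<v twin =
    subst T (to T-not-≡ first) (any-allFin⁺ (earlierTwin v) x (from T-∧ (ℕP.<⇒<ᵇ x<v , twin)))

  firstIn-unique : ∀ {u v} → T (firstIn k X u) → T (firstIn k X v) → T (discIso k X u X v) → u ≡ v
  firstIn-unique {u} {v} first-u first-v twin with ℕP.<-cmp (toℕ u) (toℕ v)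
  ... | tri< u<v _ _ = ⊥-elim (firstIn-minimal first-v u<v twin)
  ... | tri≈ _ u≡v _ = FinP.toℕ-injective u≡v
  ... | tri> _ _ v<u = ⊥-elim (firstIn-minimal first-u v<u (discIso-sym k X u X v twin))

  firstIn-exists : ∀ u → ∃ λ v → T (firstIn k X v) × T (discIso k X v X u)
  firstIn-exists u = go u (<-wellFounded u)
    where
    go : ∀ u → Acc Fin._<_ u → ∃ λ v → T (firstIn k X v) × T (discIso k X v X u)
    go u (acc earlier) with any (earlierTwin u) (allFin m) in eq
    ... | false = u , from T-not-≡ eq , discIso-refl k X u
    ... | true =
      let x , twin = any-allFin⁻ (earlierTwin u) (subst T (sym eq) _)
          x<u , x≅u = to T-∧ twin
          v , first , v≅x = go x (earlier (ℕP.<ᵇ⇒< _ _ x<u))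
      in v , first , discIso-trans k X v X x X u v≅x x≅u

⟦_⟧ : Bool → ℕ
⟦ true ⟧  = 1
⟦ false ⟧ = 0

⟦⟧-∧ : ∀ a b → ⟦ a ∧ b ⟧ ≡ ⟦ a ⟧ ℕ.* ⟦ b ⟧
⟦⟧-∧ true  b = sym (ℕP.+-identityʳ ⟦ b ⟧)
⟦⟧-∧ false b = refl

countB-tabulate : ∀ {A : Set} {n} (p : A → Bool) (f : Fin n → A) →
  countB p (tabulate f) ≡ ∑[ i < n ] ⟦ p (f i) ⟧
countB-tabulate {n = zero}  p f = refl
countB-tabulate {n = suc n} p f with p (f zero)
... | true  = cong suc (countB-tabulate p (f ∘ suc))
... | false = countB-tabulate p (f ∘ suc)

∑-mono-≤ : ∀ {n} {f g : Fin n → ℕ} → (∀ i → f i ≤ g i) → sum f ≤ sum g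
∑-mono-≤ {zero}  f≤g = z≤n
∑-mono-≤ {suc n} f≤g = ℕP.+-mono-≤ (f≤g zero) (∑-mono-≤ (f≤g ∘ suc))

∑-const : ∀ n c → ∑[ i < n ] c ≡ n ℕ.* c
∑-const zero    c = refl
∑-const (suc n) c = cong (c ℕ.+_) (∑-const n c)

∑-zero : ∀ {n} {f : Fin n → ℕ} → (∀ i → f i ≡ 0) → sum f ≡ 0
∑-zero {n} f≗0 = trans (sum-cong-≗ f≗0) (sum-replicate-zero n)

∑-term-≤ : ∀ {n} (f : Fin n → ℕ) i → f i ≤ sum f
∑-term-≤ f zero    = ℕP.m≤m+n (f zero) _
∑-term-≤ f (suc i) = ℕP.≤-trans (∑-term-≤ (f ∘ suc) i) (ℕP.m≤n+m _ (f zero))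

∑-indicator-≤1 : ∀ {n} (p : Fin n → Bool) → (∀ {i j} → T (p i) → T (p j) → i ≡ j) →
                 ∑[ i < n ] ⟦ p i ⟧ ≤ 1
∑-indicator-≤1 {zero}  p unique = z≤n
∑-indicator-≤1 {suc n} p unique with p zero in eq
... | true  = ℕP.≤-reflexive (cong suc (∑-zero others-false))
  where
  others-false : ∀ i → ⟦ p (suc i) ⟧ ≡ 0
  others-false i with p (suc i) in eq′
  ... | true with () ← unique (subst T (sym eq) _) (subst T (sym eq′) _)
  ... | false = refl
... | false = ∑-indicator-≤1 (p ∘ suc) λ pi pj → FinP.suc-injective (unique pi pj)

⟦⟧-¬T : ∀ {b} → ¬ T b → ⟦ b ⟧ ≡ 0
⟦⟧-¬T {true}  ¬b = ⊥-elim (¬b _)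
⟦⟧-¬T {false} ¬b = refl

⟦⟧-T : ∀ {b} → T b → ⟦ b ⟧ ≡ 1
⟦⟧-T {true} _ = refl

cnt≡∑ : ∀ k {l m} (X : Graph l) x (Y : Graph m) → cnt k X x Y ≡ ∑[ u < m ] ⟦ discIso k X x Y u ⟧
cnt≡∑ k X x Y = countB-tabulate (discIso k X x Y) id

∑-indicator-∧ : ∀ {n m} (a : Fin n → Bool) (b : Fin n → Fin m → Bool) →
  ∑[ v < n ] (⟦ a v ⟧ ℕ.* ∑[ u < m ] ⟦ b v u ⟧) ≡ ∑[ u < m ] ∑[ v < n ] ⟦ a v ∧ b v u ⟧
∑-indicator-∧ {n} {m} a b = begin
  ∑[ v < n ] (⟦ a v ⟧ ℕ.* ∑[ u < m ] ⟦ b v u ⟧) ≡⟨ sum-cong-≗ (λ v → *-distribˡ-sum ⟦ a v ⟧ (λ u → ⟦ b v u ⟧)) ⟩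
  ∑[ v < n ] ∑[ u < m ] (⟦ a v ⟧ ℕ.* ⟦ b v u ⟧) ≡⟨ sum-cong-≗ (λ v → sum-cong-≗ (λ u → sym (⟦⟧-∧ (a v) (b v u)))) ⟩
  ∑[ v < n ] ∑[ u < m ] ⟦ a v ∧ b v u ⟧          ≡⟨ ∑-comm (λ v u → ⟦ a v ∧ b v u ⟧) ⟩
  ∑[ u < m ] ∑[ v < n ] ⟦ a v ∧ b v u ⟧          ∎
  where open ≡-Reasoning

∑-cast : ∀ {a b} (eq : a ≡ b) (f : Fin b → ℕ) → sum f ≡ ∑[ i < a ] f (cast eq i)
∑-cast {a} refl f = sum-cong-≗ (λ i → cong f (sym (FinP.cast-is-id refl i)))

∑-↑ : ∀ a {b} (f : Fin (a ℕ.+ b) → ℕ) → sum f ≡ ∑[ i < a ] f (i ↑ˡ b) ℕ.+ ∑[ i < b ] f (a ↑ʳ i)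
∑-↑ zero    f = refl
∑-↑ (suc a) f = trans (cong (f zero ℕ.+_) (∑-↑ a (f ∘ suc))) (sym (ℕP.+-assoc (f zero) _ _))

mod-≡ : ∀ {h} .{{_ : NonZero h}} a {y : Fin h} → a ℕ.% h ≡ toℕ y → a mod h ≡ y
mod-≡ a eq = FinP.toℕ-injective (trans (FinP.toℕ-fromℕ< _) eq)

∑-periodic : ∀ {h} .{{_ : NonZero h}} q (g : Fin (q ℕ.* h) → ℕ) (g₀ : Fin h → ℕ) →
             (∀ i → g i ≡ g₀ (toℕ i mod h)) → sum g ≡ q ℕ.* sum g₀
∑-periodic         zero    g g₀ periodic = refl
∑-periodic {h} (suc q) g g₀ periodic = begin
  sum g                                                          ≡⟨ ∑-↑ h g ⟩
  ∑[ i < h ] g (i ↑ˡ q ℕ.* h) ℕ.+ ∑[ i < q ℕ.* h ] g (h ↑ʳ i)    ≡⟨ cong₂ ℕ._+_ first-block later-blocks ⟩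
  sum g₀ ℕ.+ q ℕ.* sum g₀                                        ∎
  where
  open ≡-Reasoning
  first-block : ∑[ i < h ] g (i ↑ˡ q ℕ.* h) ≡ sum g₀
  first-block = sum-cong-≗ λ i → trans (periodic _) (cong g₀ (mod-≡ (toℕ (i ↑ˡ q ℕ.* h)) (
    trans (cong (ℕ._% h) (FinP.toℕ-↑ˡ i _)) (m<n⇒m%n≡m (FinP.toℕ<n i)))))
  later-blocks : ∑[ i < q ℕ.* h ] g (h ↑ʳ i) ≡ q ℕ.* sum g₀
  later-blocks = ∑-periodic q (g ∘ (h ↑ʳ_)) g₀ λ i → trans (periodic _) (cong g₀ (mod-≡ (toℕ (h ↑ʳ i)) (begin
    toℕ (h ↑ʳ i) ℕ.% h     ≡⟨ cong (ℕ._% h) (trans (FinP.toℕ-↑ʳ h i) (ℕP.+-comm h (toℕ i))) ⟩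
    (toℕ i ℕ.+ h) ℕ.% h    ≡⟨ [m+n]%n≡m%n (toℕ i) h ⟩
    toℕ i ℕ.% h            ≡⟨ FinP.toℕ-fromℕ< _ ⟨
    toℕ (toℕ i mod h)    ∎)))

-- mkℚᵘ a N denotes a / (N + 1).
frac-toℚᵘ : ∀ a N → toℚᵘ (frac a (suc N)) ≃ᵘ mkℚᵘ (+ a) N
frac-toℚᵘ a N = ℚP.toℚᵘ-fromℚᵘ (mkℚᵘ (+ a) N)

frac-≤ : ∀ a b N M → a ℕ.* suc M ≤ b ℕ.* suc N → frac a (suc N) ℚ.≤ frac b (suc M)
frac-≤ a b N M le = ℚP.toℚᵘ-cancel-≤
  (ℚᵘP.≤-respˡ-≃ (ℚᵘP.≃-sym (frac-toℚᵘ a N)) (ℚᵘP.≤-respʳ-≃ (ℚᵘP.≃-sym (frac-toℚᵘ b M))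
    (*≤* (subst₂ ℤ._≤_ (ℤP.pos-* a (suc M)) (ℤP.pos-* b (suc N)) (ℤ.+≤+ le)))))

frac-< : ∀ a b N M → a ℕ.* suc M ℕ.< b ℕ.* suc N → frac a (suc N) ℚ.< frac b (suc M)
frac-< a b N M lt = ℚP.toℚᵘ-cancel-<
  (ℚᵘP.<-respˡ-≃ (ℚᵘP.≃-sym (frac-toℚᵘ a N)) (ℚᵘP.<-respʳ-≃ (ℚᵘP.≃-sym (frac-toℚᵘ b M))
    (*<* (subst₂ ℤ._<_ (ℤP.pos-* a (suc M)) (ℤP.pos-* b (suc N)) (ℤ.+<+ lt)))))

frac-≡ : ∀ a b N M → a ℕ.* suc M ≡ b ℕ.* suc N → frac a (suc N) ≡ frac b (suc M)
frac-≡ a b N M eq = ℚP.≤-antisym (frac-≤ a b N M (ℕP.≤-reflexive eq)) (frac-≤ b a M N (ℕP.≤-reflexive (sym eq)))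

frac-nonneg : ∀ a N → 0ℚ ℚ.≤ frac a N
frac-nonneg a zero    = ℚP.≤-refl
frac-nonneg a (suc N) = frac-≤ 0 a 0 N z≤n

frac-+ : ∀ a b N M → frac a (suc N) ℚ.+ frac b (suc M) ≡ frac (a ℕ.* suc M ℕ.+ b ℕ.* suc N) (suc N ℕ.* suc M)
frac-+ a b N M = ℚP.toℚᵘ-injective (begin-equality
  toℚᵘ (frac a (suc N) ℚ.+ frac b (suc M))         ≃⟨ ℚP.toℚᵘ-homo-+ (frac a (suc N)) (frac b (suc M)) ⟩
  toℚᵘ (frac a (suc N)) ℚᵘ.+ toℚᵘ (frac b (suc M)) ≃⟨ ℚᵘP.+-cong (frac-toℚᵘ a N) (frac-toℚᵘ b M) ⟩
  mkℚᵘ (+ a) N ℚᵘ.+ mkℚᵘ (+ b) M                   ≡⟨ cong (λ z → mkℚᵘ z (M ℕ.+ N ℕ.* suc M)) numerator ⟩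
  mkℚᵘ (+ (a ℕ.* suc M ℕ.+ b ℕ.* suc N)) (M ℕ.+ N ℕ.* suc M) ≃⟨ frac-toℚᵘ _ _ ⟨
  toℚᵘ (frac (a ℕ.* suc M ℕ.+ b ℕ.* suc N) (suc N ℕ.* suc M)) ∎)
  where
  open ℚᵘP.≤-Reasoning
  numerator : + a ℤ.* + suc M ℤ.+ + b ℤ.* + suc N ≡ + (a ℕ.* suc M ℕ.+ b ℕ.* suc N)
  numerator = trans (cong₂ ℤ._+_ (sym (ℤP.pos-* a (suc M))) (sym (ℤP.pos-* b (suc N))))
                    (sym (ℤP.pos-+ (a ℕ.* suc M) (b ℕ.* suc N)))

frac-* : ∀ a b N M → frac a (suc N) ℚ.* frac b (suc M) ≡ frac (a ℕ.* b) (suc N ℕ.* suc M)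
frac-* a b N M = ℚP.toℚᵘ-injective (begin-equality
  toℚᵘ (frac a (suc N) ℚ.* frac b (suc M))         ≃⟨ ℚP.toℚᵘ-homo-* (frac a (suc N)) (frac b (suc M)) ⟩
  toℚᵘ (frac a (suc N)) ℚᵘ.* toℚᵘ (frac b (suc M)) ≃⟨ ℚᵘP.*-cong (frac-toℚᵘ a N) (frac-toℚᵘ b M) ⟩
  mkℚᵘ (+ a) N ℚᵘ.* mkℚᵘ (+ b) M                   ≡⟨ cong (λ z → mkℚᵘ z (M ℕ.+ N ℕ.* suc M)) (sym (ℤP.pos-* a b)) ⟩
  mkℚᵘ (+ (a ℕ.* b)) (M ℕ.+ N ℕ.* suc M)           ≃⟨ frac-toℚᵘ _ _ ⟨
  toℚᵘ (frac (a ℕ.* b) (suc N ℕ.* suc M))          ∎)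
  where open ℚᵘP.≤-Reasoning

frac-+-same : ∀ a b N → frac a (suc N) ℚ.+ frac b (suc N) ≡ frac (a ℕ.+ b) (suc N)
frac-+-same a b N =
  trans (frac-+ a b N N) (frac-≡ (a ℕ.* suc N ℕ.+ b ℕ.* suc N) (a ℕ.+ b) (N ℕ.+ N ℕ.* suc N) N (cancel a b (suc N)))
  where
  cancel : ∀ a b s → (a ℕ.* s ℕ.+ b ℕ.* s) ℕ.* s ≡ (a ℕ.+ b) ℕ.* (s ℕ.* s)
  cancel = solve-∀

sumℚ-mono-≤ : ∀ {A : Set} {f g : A → ℚ} xs → (∀ x → f x ℚ.≤ g x) → sumℚ f xs ℚ.≤ sumℚ g xs
sumℚ-mono-≤ []       f≤g = ℚP.≤-refl
sumℚ-mono-≤ (x ∷ xs) f≤g = ℚP.+-mono-≤ (f≤g x) (sumℚ-mono-≤ xs f≤g)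

sumℚ-+ : ∀ {A : Set} (f g : A → ℚ) xs → sumℚ (λ x → f x ℚ.+ g x) xs ≡ sumℚ f xs ℚ.+ sumℚ g xs
sumℚ-+ f g []       = sym (ℚP.+-identityˡ 0ℚ)
sumℚ-+ f g (x ∷ xs) = trans (cong (f x ℚ.+ g x ℚ.+_) (sumℚ-+ f g xs))
  (solve 4 (λ a b c d → (a :+ b) :+ (c :+ d) := (a :+ c) :+ (b :+ d)) refl (f x) (g x) (sumℚ f xs) (sumℚ g xs))

sumℚ-frac : ∀ {A : Set} N {n} (f : Fin n → A) (P : A → Bool) (w : A → ℕ) →
  sumℚ (λ x → if P x then frac (w x) (suc N) else 0ℚ) (tabulate f)
    ≡ frac (∑[ i < n ] (⟦ P (f i) ⟧ ℕ.* w (f i))) (suc N)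
sumℚ-frac N {zero}  f P w = frac-≡ 0 0 0 N refl
sumℚ-frac N {suc n} f P w with P (f zero)
... | true  = trans (cong (frac (w (f zero)) (suc N) ℚ.+_) (sumℚ-frac N (f ∘ suc) P w))
                    (trans (frac-+-same (w (f zero)) rest N)
                           (cong (λ a → frac (a ℕ.+ rest) (suc N)) (sym (ℕP.+-identityʳ (w (f zero))))))
  where rest = ∑[ i < n ] (⟦ P (f (suc i)) ⟧ ℕ.* w (f (suc i)))
... | false = trans (ℚP.+-identityˡ _) (sumℚ-frac N (f ∘ suc) P w)

cross-multiplied : ∀ {q r h n} c ρ → n ≡ q ℕ.* h ℕ.+ r →
  (c ℕ.* n ℕ.+ ρ ℕ.* h) ℕ.* (n ℕ.* (h ℕ.* n)) ≡ ((q ℕ.* c ℕ.+ ρ) ℕ.* (h ℕ.* n) ℕ.+ r ℕ.* c ℕ.* n) ℕ.* (h ℕ.* n)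
cross-multiplied {q} {r} {h} {n} c ρ n≡qh+r = begin
  (c ℕ.* n ℕ.+ ρ ℕ.* h) ℕ.* (n ℕ.* (h ℕ.* n))
    ≡⟨ expand c ρ h n ⟩
  (n ℕ.* c ℕ.* n ℕ.+ ρ ℕ.* h ℕ.* n) ℕ.* (h ℕ.* n)
    ≡⟨ cong (λ m → (m ℕ.* c ℕ.* n ℕ.+ ρ ℕ.* h ℕ.* n) ℕ.* (h ℕ.* n)) n≡qh+r ⟩
  ((q ℕ.* h ℕ.+ r) ℕ.* c ℕ.* n ℕ.+ ρ ℕ.* h ℕ.* n) ℕ.* (h ℕ.* n)
    ≡⟨ regroup q r c ρ h n ⟩
  ((q ℕ.* c ℕ.+ ρ) ℕ.* (h ℕ.* n) ℕ.+ r ℕ.* c ℕ.* n) ℕ.* (h ℕ.* n) ∎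
  where
  open ≡-Reasoning
  expand : ∀ c ρ h n → (c ℕ.* n ℕ.+ ρ ℕ.* h) ℕ.* (n ℕ.* (h ℕ.* n))
                     ≡ (n ℕ.* c ℕ.* n ℕ.+ ρ ℕ.* h ℕ.* n) ℕ.* (h ℕ.* n)
  expand = solve-∀
  regroup : ∀ q r c ρ h n → ((q ℕ.* h ℕ.+ r) ℕ.* c ℕ.* n ℕ.+ ρ ℕ.* h ℕ.* n) ℕ.* (h ℕ.* n)
                          ≡ ((q ℕ.* c ℕ.+ ρ) ℕ.* (h ℕ.* n) ℕ.+ r ℕ.* c ℕ.* n) ℕ.* (h ℕ.* n)
  regroup = solve-∀

module _ {q r h′ n′ : ℕ} (n≡qh+r : suc n′ ≡ q ℕ.* suc h′ ℕ.+ r) where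

  private
    h n hn′ : ℕ
    h = suc h′
    n = suc n′
    hn′ = n′ ℕ.+ h′ ℕ.* n

  ∣a-[qc+ρ]/n∣≤∣a-c/h∣+rc/hn+ρ/n : ∀ (a : ℚ) c ρ →
    ∣ a ℚ.- frac (q ℕ.* c ℕ.+ ρ) n ∣ ℚ.≤ ∣ a ℚ.- frac c h ∣ ℚ.+ frac (r ℕ.* c) (h ℕ.* n) ℚ.+ frac ρ n
  ∣a-[qc+ρ]/n∣≤∣a-c/h∣+rc/hn+ρ/n a c ρ = begin
    ∣ a ℚ.- B ∣                       ≡⟨ cong ∣_∣ (solve 3 (λ a b c → a :- b := (a :- c) :+ (c :- b)) refl a B C) ⟩
    ∣ (a ℚ.- C) ℚ.+ (C ℚ.- B) ∣       ≤⟨ ℚP.∣p+q∣≤∣p∣+∣q∣ (a ℚ.- C) (C ℚ.- B) ⟩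
    ∣ a ℚ.- C ∣ ℚ.+ ∣ C ℚ.- B ∣       ≡⟨ cong (λ z → ∣ a ℚ.- C ∣ ℚ.+ ∣ z ∣) C-B≡X-Y ⟩
    ∣ a ℚ.- C ∣ ℚ.+ ∣ X ℚ.- Y ∣       ≤⟨ ℚP.+-monoʳ-≤ ∣ a ℚ.- C ∣ (ℚP.∣p-q∣≤∣p∣+∣q∣ X Y) ⟩
    ∣ a ℚ.- C ∣ ℚ.+ (∣ X ∣ ℚ.+ ∣ Y ∣) ≡⟨ cong₂ (λ x y → ∣ a ℚ.- C ∣ ℚ.+ (x ℚ.+ y))
                                                (ℚP.0≤p⇒∣p∣≡p (frac-nonneg (r ℕ.* c) (h ℕ.* n)))
                                                (ℚP.0≤p⇒∣p∣≡p (frac-nonneg ρ n)) ⟩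
    ∣ a ℚ.- C ∣ ℚ.+ (X ℚ.+ Y)         ≡⟨ ℚP.+-assoc ∣ a ℚ.- C ∣ X Y ⟨
    ∣ a ℚ.- C ∣ ℚ.+ X ℚ.+ Y           ∎
    where
    open ℚP.≤-Reasoning
    B C X Y : ℚ
    B = frac (q ℕ.* c ℕ.+ ρ) n
    C = frac c h
    X = frac (r ℕ.* c) (h ℕ.* n)
    Y = frac ρ n
    C+Y≡B+X : C ℚ.+ Y ≡ B ℚ.+ X
    C+Y≡B+X = begin-equality
      C ℚ.+ Y
        ≡⟨ frac-+ c ρ h′ n′ ⟩
      frac (c ℕ.* n ℕ.+ ρ ℕ.* h) (h ℕ.* n)
        ≡⟨ frac-≡ (c ℕ.* n ℕ.+ ρ ℕ.* h) ((q ℕ.* c ℕ.+ ρ) ℕ.* (h ℕ.* n) ℕ.+ r ℕ.* c ℕ.* n)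
                  hn′ (hn′ ℕ.+ n′ ℕ.* suc hn′) (cross-multiplied {q} {r} c ρ n≡qh+r) ⟩
      frac ((q ℕ.* c ℕ.+ ρ) ℕ.* (h ℕ.* n) ℕ.+ r ℕ.* c ℕ.* n) (n ℕ.* (h ℕ.* n))
        ≡⟨ frac-+ (q ℕ.* c ℕ.+ ρ) (r ℕ.* c) n′ hn′ ⟨
      B ℚ.+ X ∎
    C-B≡X-Y : C ℚ.- B ≡ X ℚ.- Y
    C-B≡X-Y = begin-equality
      C ℚ.- B                   ≡⟨ solve 3 (λ c b y → c :- b := (c :+ y) :- b :- y) refl C B Y ⟩
      (C ℚ.+ Y) ℚ.- B ℚ.- Y     ≡⟨ cong (λ z → z ℚ.- B ℚ.- Y) C+Y≡B+X ⟩
      (B ℚ.+ X) ℚ.- B ℚ.- Y     ≡⟨ solve 3 (λ b x y → (b :+ x) :- b :- y := x :- y) refl B X Y ⟩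
      X ℚ.- Y                   ∎


-- Counting disc classes

module Representatives (k : ℕ) {n} (G : Graph n) where

  unmatched : ∀ {m} → Graph m → Fin m → Bool
  unmatched Y u = not (any (λ x → discIso k G x Y u) (allFin n))

  module _ {m} (Y : Graph m) where

    unmatched⇒¬discIso : ∀ {u} → T (unmatched Y u) → ∀ x → ¬ T (discIso k G x Y u)
    unmatched⇒¬discIso {u} t x x≅u = subst T (to T-not-≡ t) (any-allFin⁺ (λ x → discIso k G x Y u) x x≅u)

    ¬unmatched⇒discIso : ∀ {u} → ¬ T (unmatched Y u) → ∃ λ x → T (discIso k G x Y u)
    ¬unmatched⇒discIso {u} ¬t with any (λ x → discIso k G x Y u) (allFin n) in eq
    ... | true  = any-allFin⁻ (λ x → discIso k G x Y u) (subst T (sym eq) _)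
    ... | false = ⊥-elim (¬t _)

    one-class-per-vertex : ∀ u → ∑[ v < n ] ⟦ firstIn k G v ∧ discIso k G v Y u ⟧ ℕ.+ ⟦ unmatched Y u ⟧ ≤ 1
    one-class-per-vertex u with T? (unmatched Y u)
    ... | yes t = ℕP.≤-reflexive (cong₂ ℕ._+_ (∑-zero no-class) (⟦⟧-T t))
      where
      no-class : ∀ v → ⟦ firstIn k G v ∧ discIso k G v Y u ⟧ ≡ 0
      no-class v = ⟦⟧-¬T (unmatched⇒¬discIso t v ∘ proj₂ ∘ to T-∧)
    ... | no ¬t = begin
      ∑[ v < n ] ⟦ firstIn k G v ∧ discIso k G v Y u ⟧ ℕ.+ ⟦ unmatched Y u ⟧ ≡⟨ cong₂ ℕ._+_ refl (⟦⟧-¬T ¬t) ⟩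
      ∑[ v < n ] ⟦ firstIn k G v ∧ discIso k G v Y u ⟧ ℕ.+ 0                 ≡⟨ ℕP.+-identityʳ _ ⟩
      ∑[ v < n ] ⟦ firstIn k G v ∧ discIso k G v Y u ⟧
        ≤⟨ ∑-indicator-≤1 (λ v → firstIn k G v ∧ discIso k G v Y u) same-class ⟩
      1 ∎
      where
      open ℕP.≤-Reasoning
      same-class : ∀ {v w} → T (firstIn k G v ∧ discIso k G v Y u) → T (firstIn k G w ∧ discIso k G w Y u) → v ≡ w
      same-class {v} {w} tv tw =
        let first-v , v≅u = to T-∧ tv ; first-w , w≅u = to T-∧ tw
        in firstIn-unique k G first-v first-w (discIso-trans k G v Y u G w v≅u (discIso-sym k G w Y u w≅u))

    classes-count-≤ : ∀ {r} (s : Fin r → Fin m) →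
      ∑[ v < n ] (⟦ firstIn k G v ⟧ ℕ.* ∑[ i < r ] ⟦ discIso k G v Y (s i) ⟧) ℕ.+ ∑[ i < r ] ⟦ unmatched Y (s i) ⟧ ≤ r
    classes-count-≤ {r} s = begin
      ∑[ v < n ] (⟦ firstIn k G v ⟧ ℕ.* ∑[ i < r ] ⟦ discIso k G v Y (s i) ⟧) ℕ.+ ∑[ i < r ] ⟦ unmatched Y (s i) ⟧
        ≡⟨ cong₂ ℕ._+_ (∑-indicator-∧ (firstIn k G) (λ v i → discIso k G v Y (s i))) refl ⟩
      ∑[ i < r ] ∑[ v < n ] ⟦ firstIn k G v ∧ discIso k G v Y (s i) ⟧ ℕ.+ ∑[ i < r ] ⟦ unmatched Y (s i) ⟧
        ≡⟨ ∑-distrib-+ (λ i → ∑[ v < n ] ⟦ firstIn k G v ∧ discIso k G v Y (s i) ⟧)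
                       (λ i → ⟦ unmatched Y (s i) ⟧) ⟨
      ∑[ i < r ] (∑[ v < n ] ⟦ firstIn k G v ∧ discIso k G v Y (s i) ⟧ ℕ.+ ⟦ unmatched Y (s i) ⟧)
        ≤⟨ ∑-mono-≤ (one-class-per-vertex ∘ s) ⟩
      ∑[ i < r ] 1
        ≡⟨ trans (∑-const r 1) (ℕP.*-identityʳ r) ⟩
      r ∎
      where open ℕP.≤-Reasoning

    unmatched-class-size : ∀ y → ∑[ u < m ] ⟦ (firstIn k Y u ∧ unmatched Y u) ∧ discIso k Y u Y y ⟧ ≡ ⟦ unmatched Y y ⟧
    unmatched-class-size y with T? (unmatched Y y)
    ... | yes t = trans (ℕP.≤-antisym (∑-indicator-≤1 counted same-class)
                                      (subst (_≤ ∑[ u < m ] ⟦ counted u ⟧) (⟦⟧-T rep-counted) (∑-term-≤ (⟦_⟧ ∘ counted) rep)))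
                        (sym (⟦⟧-T t))
      where
      counted : Fin m → Bool
      counted u = (firstIn k Y u ∧ unmatched Y u) ∧ discIso k Y u Y y
      rep = proj₁ (firstIn-exists k Y y)
      first-rep = proj₁ (proj₂ (firstIn-exists k Y y))
      rep≅y = proj₂ (proj₂ (firstIn-exists k Y y))
      rep-unmatched : T (unmatched Y rep)
      rep-unmatched with T? (unmatched Y rep)
      ... | yes u = u
      ... | no ¬u = let x , x≅rep = ¬unmatched⇒discIso ¬u in
                    ⊥-elim (unmatched⇒¬discIso t x (discIso-trans k G x Y rep Y y x≅rep rep≅y))
      rep-counted : T ((firstIn k Y rep ∧ unmatched Y rep) ∧ discIso k Y rep Y y)
      rep-counted = from T-∧ (from T-∧ (first-rep , rep-unmatched) , rep≅y)
      same-class : ∀ {u w} → T ((firstIn k Y u ∧ unmatched Y u) ∧ discIso k Y u Y y) →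
                   T ((firstIn k Y w ∧ unmatched Y w) ∧ discIso k Y w Y y) → u ≡ w
      same-class {u} {w} tu tw =
        let fu , u≅y = to T-∧ tu ; fw , w≅y = to T-∧ tw
        in firstIn-unique k Y (proj₁ (to T-∧ fu)) (proj₁ (to T-∧ fw))
                          (discIso-trans k Y u Y y Y w u≅y (discIso-sym k Y w Y y w≅y))
    ... | no ¬t = trans (∑-zero not-counted) (sym (⟦⟧-¬T ¬t))
      where
      not-counted : ∀ u → ⟦ (firstIn k Y u ∧ unmatched Y u) ∧ discIso k Y u Y y ⟧ ≡ 0
      not-counted u = ⟦⟧-¬T λ tu →
        let fu , u≅y = to T-∧ tu ; x , x≅y = ¬unmatched⇒discIso ¬t in
        unmatched⇒¬discIso (proj₂ (to T-∧ fu)) x (discIso-trans k G x Y y Y u x≅y (discIso-sym k Y u Y y u≅y))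

    unmatched-classes-cover : ∑[ u < m ] (⟦ firstIn k Y u ∧ unmatched Y u ⟧ ℕ.* cnt k Y u Y) ≡ ∑[ y < m ] ⟦ unmatched Y y ⟧
    unmatched-classes-cover = begin
      ∑[ u < m ] (⟦ firstIn k Y u ∧ unmatched Y u ⟧ ℕ.* cnt k Y u Y)
        ≡⟨ sum-cong-≗ (λ u → cong (⟦ firstIn k Y u ∧ unmatched Y u ⟧ ℕ.*_) (cnt≡∑ k Y u Y)) ⟩
      ∑[ u < m ] (⟦ firstIn k Y u ∧ unmatched Y u ⟧ ℕ.* ∑[ y < m ] ⟦ discIso k Y u Y y ⟧)
        ≡⟨ ∑-indicator-∧ (λ u → firstIn k Y u ∧ unmatched Y u) (λ u y → discIso k Y u Y y) ⟩
      ∑[ y < m ] ∑[ u < m ] ⟦ (firstIn k Y u ∧ unmatched Y u) ∧ discIso k Y u Y y ⟧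
        ≡⟨ sum-cong-≗ unmatched-class-size ⟩
      ∑[ y < m ] ⟦ unmatched Y y ⟧ ∎
      where open ≡-Reasoning

    dist1ᴳ dist1ʸ : ℚ
    dist1ᴳ = sumℚ (λ v → if firstIn k G v then ∣ frac (cnt k G v G) n ℚ.- frac (cnt k G v Y) m ∣ else 0ℚ) (allFin n)
    dist1ʸ = sumℚ (λ u → if firstIn k Y u ∧ unmatched Y u then frac (cnt k Y u Y) m else 0ℚ) (allFin m)

    representatives-cnt-≤ : ∑[ v < n ] (⟦ firstIn k G v ⟧ ℕ.* cnt k G v Y) ≤ m
    representatives-cnt-≤ = begin
      ∑[ v < n ] (⟦ firstIn k G v ⟧ ℕ.* cnt k G v Y)
        ≡⟨ sum-cong-≗ (λ v → cong (⟦ firstIn k G v ⟧ ℕ.*_) (cnt≡∑ k G v Y)) ⟩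
      ∑[ v < n ] (⟦ firstIn k G v ⟧ ℕ.* ∑[ u < m ] ⟦ discIso k G v Y u ⟧)
        ≤⟨ ℕP.m≤m+n _ _ ⟩
      ∑[ v < n ] (⟦ firstIn k G v ⟧ ℕ.* ∑[ u < m ] ⟦ discIso k G v Y u ⟧) ℕ.+ ∑[ u < m ] ⟦ unmatched Y u ⟧
        ≤⟨ classes-count-≤ id ⟩
      m ∎
      where open ℕP.≤-Reasoning

  dist1ʸ-unmatched : ∀ {m′} (Y : Graph (suc m′)) → dist1ʸ Y ≡ frac (∑[ u < suc m′ ] ⟦ unmatched Y u ⟧) (suc m′)
  dist1ʸ-unmatched {m′} Y = trans (sumℚ-frac m′ id (λ u → firstIn k Y u ∧ unmatched Y u) (λ u → cnt k Y u Y))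
                                  (cong (λ a → frac a (suc m′)) (unmatched-classes-cover Y))

-- The blow-up

module BlowUp (n h′ : ℕ) (H₀ : Graph (suc h′)) where

  h q r : ℕ
  h = suc h′
  q = n ℕ./ h
  r = n ℕ.% h

  H : Graph n
  H = blowUp n h H₀

  n≡qh+r : n ≡ q ℕ.* h ℕ.+ r
  n≡qh+r = trans (m≡m%n+[m/n]*n n h) (ℕP.+-comm r (q ℕ.* h))

  private
    copy-bound : ∀ {c} → c ℕ.< q → (y : Fin h) → toℕ y ℕ.+ c ℕ.* h ℕ.< n
    copy-bound {c} c<q y = begin-strict
      toℕ y ℕ.+ c ℕ.* h <⟨ ℕP.+-monoˡ-< (c ℕ.* h) (FinP.toℕ<n y) ⟩
      h ℕ.+ c ℕ.* h     ≤⟨ ℕP.*-monoˡ-≤ h c<q ⟩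
      q ℕ.* h           ≤⟨ m/n*n≤m n h ⟩
      n                 ∎
      where open ℕP.≤-Reasoning

  copy : ∀ {c} → c ℕ.< q → Fin h → Fin n
  copy c<q y = fromℕ< (copy-bound c<q y)

  module _ {c} (c<q : c ℕ.< q) where

    toℕ-copy : ∀ y → toℕ (copy c<q y) ≡ toℕ y ℕ.+ c ℕ.* h
    toℕ-copy y = FinP.toℕ-fromℕ< (copy-bound c<q y)

    copy-block : ∀ y → toℕ (copy c<q y) ℕ./ h ≡ c
    copy-block y = begin
      toℕ (copy c<q y) ℕ./ h         ≡⟨ cong (ℕ._/ h) (toℕ-copy y) ⟩
      (toℕ y ℕ.+ c ℕ.* h) ℕ./ h      ≡⟨ +-distrib-/-∣ʳ (toℕ y) (divides-refl c) ⟩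
      toℕ y ℕ./ h ℕ.+ c ℕ.* h ℕ./ h  ≡⟨ cong₂ ℕ._+_ (m<n⇒m/n≡0 (FinP.toℕ<n y)) (m*n/n≡m c h) ⟩
      c                              ∎
      where open ≡-Reasoning

    copy-offset : ∀ y → toℕ (copy c<q y) mod h ≡ y
    copy-offset y = mod-≡ (toℕ (copy c<q y)) (begin
      toℕ (copy c<q y) ℕ.% h     ≡⟨ cong (ℕ._% h) (toℕ-copy y) ⟩
      (toℕ y ℕ.+ c ℕ.* h) ℕ.% h  ≡⟨ [m+kn]%n≡m%n (toℕ y) c h ⟩
      toℕ y ℕ.% h                ≡⟨ m<n⇒m%n≡m (FinP.toℕ<n y) ⟩
      toℕ y                      ∎)
      where open ≡-Reasoning

    copy-injective : ∀ {a b} → copy c<q a ≡ copy c<q b → a ≡ b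
    copy-injective {a} {b} eq = trans (sym (copy-offset a)) (trans (cong (λ j → toℕ j mod h) eq) (copy-offset b))

    copy-of-block : ∀ j → toℕ j ℕ./ h ≡ c → copy c<q (toℕ j mod h) ≡ j
    copy-of-block j j/h≡c = FinP.toℕ-injective (begin
      toℕ (copy c<q (toℕ j mod h))       ≡⟨ toℕ-copy (toℕ j mod h) ⟩
      toℕ (toℕ j mod h) ℕ.+ c ℕ.* h      ≡⟨ cong₂ (λ a b → a ℕ.+ b ℕ.* h) (FinP.toℕ-fromℕ< _) (sym j/h≡c) ⟩
      toℕ j ℕ.% h ℕ.+ toℕ j ℕ./ h ℕ.* h  ≡⟨ m≡m%n+[m/n]*n (toℕ j) h ⟨
      toℕ j                              ∎)
      where open ≡-Reasoning

    copy-edge : ∀ a b → H (copy c<q a) (copy c<q b) ≡ H₀ a b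
    copy-edge a b rewrite copy-block a | copy-block b | copy-offset a | copy-offset b
                        | to T-≡ (ℕP.≡⇒≡ᵇ c c refl) | to T-≡ (ℕP.<⇒<ᵇ c<q) = refl

    copy-neighbour : ∀ a {w} → T (H (copy c<q a) w) → ∃ λ b → copy c<q b ≡ w × T (H₀ a b)
    copy-neighbour a {w} t = b , b↦w , subst T (copy-edge a b) (subst (T ∘ H (copy c<q a)) (sym b↦w) t)
      where
      b = toℕ w mod h
      b↦w : copy c<q b ≡ w
      b↦w = copy-of-block w (sym (trans (sym (copy-block a)) (ℕP.≡ᵇ⇒≡ _ _ (proj₁ (to T-∧ t)))))

    ball-copy⁻ : ∀ k a {u} → InBall H k (copy c<q a) u → ∃ λ b → copy c<q b ≡ u × InBall H₀ k a b
    ball-copy⁻ zero    a t = a , to T-==F t , from T-==F refl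
    ball-copy⁻ (suc k) a {u} t with to T-∨ t
    ... | inj₁ near = let b , b↦u , ab = ball-copy⁻ k a near in b , b↦u , from T-∨ (inj₁ ab)
    ... | inj₂ via =
      let w , t′ = any-allFin⁻ (λ w → H (copy c<q a) w ∧ reach H k w u) via
          aw , wu = to T-∧ t′
          a′ , a′↦w , aa′ = copy-neighbour a aw
          b , b↦u , a′b = ball-copy⁻ k a′ (subst (λ z → InBall H k z u) (sym a′↦w) wu)
      in b , b↦u , from (T-∨ {reach H₀ k a b})
                          (inj₂ (any-allFin⁺ (λ w → H₀ a w ∧ reach H₀ k w b) a′ (from T-∧ (aa′ , a′b))))

    ball-copy⁺ : ∀ k {a b} → InBall H₀ k a b → InBall H k (copy c<q a) (copy c<q b)
    ball-copy⁺ zero    t = from T-==F (cong (copy c<q) (to T-==F t))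
    ball-copy⁺ (suc k) {a} {b} t with to T-∨ t
    ... | inj₁ near = from T-∨ (inj₁ (ball-copy⁺ k near))
    ... | inj₂ via =
      let a′ , t′ = any-allFin⁻ (λ w → H₀ a w ∧ reach H₀ k w b) via
          aa′ , a′b = to T-∧ t′
      in from (T-∨ {reach H k (copy c<q a) (copy c<q b)})
              (inj₂ (any-allFin⁺ (λ w → H (copy c<q a) w ∧ reach H k w (copy c<q b)) (copy c<q a′)
                                 (from T-∧ (subst T (sym (copy-edge a a′)) aa′ , ball-copy⁺ k a′b))))

    DiscIso-copy : ∀ k a → DiscIso k H₀ a H (copy c<q a) (copy c<q)
    DiscIso-copy k a = record
      { root = refl
      ; into = ball-copy⁺ k
      ; inj  = λ _ _ → copy-injective
      ; onto = λ ru → let b , b↦u , ab = ball-copy⁻ k a ru in b , ab , b↦u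
      ; edge = λ {a′} {b′} _ _ → sym (copy-edge a′ b′)
      }

  discIso-copy : ∀ k {m} (X : Graph m) x j → toℕ j ℕ./ h ℕ.< q →
                 discIso k X x H j ≡ discIso k X x H₀ (toℕ j mod h)
  discIso-copy k X x j j<q = T-injective
      (λ t → discIso-trans k X x H j H₀ y t (discIso-sym k H₀ y H j j≅y))
      (λ t → discIso-trans k X x H₀ y H j t j≅y)
    where
    y = toℕ j mod h
    j≅y : T (discIso k H₀ y H j)
    j≅y = subst (λ z → T (discIso k H₀ y H z)) (copy-of-block j<q j refl)
                (discIso⁺ k H₀ y H _ (DiscIso-copy j<q k y))

  leftover : Fin r → Fin n
  leftover i = cast (sym n≡qh+r) (q ℕ.* h ↑ʳ i)

  ∑-blowUp : (f : Fin n → ℕ) (g₀ : Fin h → ℕ) → (∀ j → toℕ j ℕ./ h ℕ.< q → f j ≡ g₀ (toℕ j mod h)) →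
             sum f ≡ q ℕ.* sum g₀ ℕ.+ ∑[ i < r ] f (leftover i)
  ∑-blowUp f g₀ periodic = begin
    sum f
      ≡⟨ ∑-cast (sym n≡qh+r) f ⟩
    ∑[ i < q ℕ.* h ℕ.+ r ] f (cast (sym n≡qh+r) i)
      ≡⟨ ∑-↑ (q ℕ.* h) (f ∘ cast (sym n≡qh+r)) ⟩
    ∑[ i < q ℕ.* h ] f (inCopy i) ℕ.+ ∑[ i < r ] f (leftover i)
      ≡⟨ cong₂ ℕ._+_ (∑-periodic q (f ∘ inCopy) g₀ inCopy-periodic) refl ⟩
    q ℕ.* sum g₀ ℕ.+ ∑[ i < r ] f (leftover i) ∎
    where
    open ≡-Reasoning
    inCopy : Fin (q ℕ.* h) → Fin n
    inCopy i = cast (sym n≡qh+r) (i ↑ˡ r)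
    toℕ-inCopy : ∀ i → toℕ (inCopy i) ≡ toℕ i
    toℕ-inCopy i = trans (FinP.toℕ-cast _ (i ↑ˡ r)) (FinP.toℕ-↑ˡ i r)
    inCopy-periodic : ∀ i → f (inCopy i) ≡ g₀ (toℕ i mod h)
    inCopy-periodic i =
      trans (periodic (inCopy i) (m<n*o⇒m/o<n (subst (ℕ._< q ℕ.* h) (sym (toℕ-inCopy i)) (FinP.toℕ<n i))))
            (cong (λ a → g₀ (a mod h)) (toℕ-inCopy i))

  cnt-blowUp : ∀ k {m} (X : Graph m) x →
    cnt k X x H ≡ q ℕ.* cnt k X x H₀ ℕ.+ ∑[ i < r ] ⟦ discIso k X x H (leftover i) ⟧
  cnt-blowUp k X x = begin
    cnt k X x H
      ≡⟨ cnt≡∑ k X x H ⟩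
    ∑[ j < n ] ⟦ discIso k X x H j ⟧
      ≡⟨ ∑-blowUp (λ j → ⟦ discIso k X x H j ⟧) (λ y → ⟦ discIso k X x H₀ y ⟧)
                  (λ j j<q → cong ⟦_⟧ (discIso-copy k X x j j<q)) ⟩
    q ℕ.* ∑[ y < h ] ⟦ discIso k X x H₀ y ⟧ ℕ.+ leftover-count
      ≡⟨ cong (λ c → q ℕ.* c ℕ.+ leftover-count) (cnt≡∑ k X x H₀) ⟨
    q ℕ.* cnt k X x H₀ ℕ.+ leftover-count
      ∎
    where
    open ≡-Reasoning
    leftover-count = ∑[ i < r ] ⟦ discIso k X x H (leftover i) ⟧

  module _ (k : ℕ) (G : Graph n) where
    open Representatives k G

    unmatched-blowUp :
      ∑[ j < n ] ⟦ unmatched H j ⟧ ≡ q ℕ.* ∑[ y < h ] ⟦ unmatched H₀ y ⟧ ℕ.+ ∑[ i < r ] ⟦ unmatched H (leftover i) ⟧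
    unmatched-blowUp = ∑-blowUp (λ j → ⟦ unmatched H j ⟧) (λ y → ⟦ unmatched H₀ y ⟧) λ j j<q →
      cong (λ b → ⟦ not b ⟧) (cong or (map-cong (λ x → discIso-copy k G x j j<q) (allFin n)))

if-then-0-≤ : ∀ b {x y z w : ℚ} → x ℚ.≤ y ℚ.+ z ℚ.+ w →
  (if b then x else 0ℚ) ℚ.≤ (if b then y else 0ℚ) ℚ.+ (if b then z else 0ℚ) ℚ.+ (if b then w else 0ℚ)
if-then-0-≤ true  x≤ = x≤
if-then-0-≤ false _  = ℚP.≤-refl

module BlowUpEstimate (k : ℕ) {n′ h′ : ℕ} (G : Graph (suc n′)) (H₀ : Graph (suc h′)) where

  open BlowUp (suc n′) h′ H₀
  open Representatives k G

  private
    n hn′ : ℕ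
    n = suc n′
    hn′ = n′ ℕ.+ h′ ℕ.* n

    first : Fin n → Bool
    first = firstIn k G

    c ρ : Fin n → ℕ
    c v = cnt k G v H₀
    ρ v = ∑[ i < r ] ⟦ discIso k G v H (leftover i) ⟧

    Σρ τ : ℕ
    Σρ = ∑[ v < n ] (⟦ first v ⟧ ℕ.* ρ v)
    τ = ∑[ i < r ] ⟦ unmatched H (leftover i) ⟧

  leftover-classes-≤ : Σρ ℕ.+ τ ≤ r
  leftover-classes-≤ = classes-count-≤ H leftover

  ∑-rc/hn≤r/n : sumℚ (λ v → if first v then frac (r ℕ.* c v) (h ℕ.* n) else 0ℚ) (allFin n) ℚ.≤ frac r n
  ∑-rc/hn≤r/n = begin
    sumℚ (λ v → if first v then frac (r ℕ.* c v) (h ℕ.* n) else 0ℚ) (allFin n)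
      ≡⟨ sumℚ-frac hn′ id first (λ v → r ℕ.* c v) ⟩
    frac (∑[ v < n ] (⟦ first v ⟧ ℕ.* (r ℕ.* c v))) (h ℕ.* n)
      ≤⟨ frac-≤ (∑[ v < n ] (⟦ first v ⟧ ℕ.* (r ℕ.* c v))) r hn′ n′ bound ⟩
    frac r n ∎
    where
    open ℚP.≤-Reasoning
    swap : ∀ a b x → a ℕ.* (b ℕ.* x) ≡ b ℕ.* (a ℕ.* x)
    swap = solve-∀
    pull-r : ∑[ v < n ] (⟦ first v ⟧ ℕ.* (r ℕ.* c v)) ≡ r ℕ.* ∑[ v < n ] (⟦ first v ⟧ ℕ.* c v)
    pull-r = trans (sum-cong-≗ (λ v → swap ⟦ first v ⟧ r (c v))) (sym (*-distribˡ-sum r (λ v → ⟦ first v ⟧ ℕ.* c v)))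
    bound : ∑[ v < n ] (⟦ first v ⟧ ℕ.* (r ℕ.* c v)) ℕ.* n ≤ r ℕ.* (h ℕ.* n)
    bound = ℕP.≤-trans (ℕP.≤-reflexive (cong (ℕ._* n) pull-r))
              (ℕP.≤-trans (ℕP.*-monoˡ-≤ n (ℕP.*-monoʳ-≤ r (representatives-cnt-≤ H₀)))
                          (ℕP.≤-reflexive (ℕP.*-assoc r h n)))

  dist1ᴳ-blowUp-≤ : dist1ᴳ H ℚ.≤ dist1ᴳ H₀ ℚ.+ frac r n ℚ.+ frac Σρ n
  dist1ᴳ-blowUp-≤ = begin
    dist1ᴳ H                                            ≤⟨ sumℚ-mono-≤ (allFin n) termwise ⟩
    sumℚ (λ v → T₀ v ℚ.+ T₁ v ℚ.+ T₂ v) (allFin n)      ≡⟨ sumℚ-+ (λ v → T₀ v ℚ.+ T₁ v) T₂ (allFin n) ⟩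
    sumℚ (λ v → T₀ v ℚ.+ T₁ v) (allFin n) ℚ.+ ∑T₂       ≡⟨ cong (ℚ._+ ∑T₂) (sumℚ-+ T₀ T₁ (allFin n)) ⟩
    dist1ᴳ H₀ ℚ.+ sumℚ T₁ (allFin n) ℚ.+ ∑T₂            ≤⟨ ℚP.+-monoˡ-≤ ∑T₂ (ℚP.+-monoʳ-≤ (dist1ᴳ H₀) ∑-rc/hn≤r/n) ⟩
    dist1ᴳ H₀ ℚ.+ frac r n ℚ.+ ∑T₂                      ≡⟨ cong (dist1ᴳ H₀ ℚ.+ frac r n ℚ.+_) (sumℚ-frac n′ id first ρ) ⟩
    dist1ᴳ H₀ ℚ.+ frac r n ℚ.+ frac Σρ n                ∎
    where
    open ℚP.≤-Reasoning
    a : Fin n → ℚ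
    a v = frac (cnt k G v G) n
    T₀ T₁ T₂ : Fin n → ℚ
    T₀ v = if first v then ∣ a v ℚ.- frac (c v) h ∣ else 0ℚ
    T₁ v = if first v then frac (r ℕ.* c v) (h ℕ.* n) else 0ℚ
    T₂ v = if first v then frac (ρ v) n else 0ℚ
    ∑T₂ : ℚ
    ∑T₂ = sumℚ T₂ (allFin n)
    termwise : ∀ v → (if first v then ∣ a v ℚ.- frac (cnt k G v H) n ∣ else 0ℚ) ℚ.≤ T₀ v ℚ.+ T₁ v ℚ.+ T₂ v
    termwise v = if-then-0-≤ (first v)
      (subst (λ m → ∣ a v ℚ.- frac m n ∣ ℚ.≤ ∣ a v ℚ.- frac (c v) h ∣ ℚ.+ frac (r ℕ.* c v) (h ℕ.* n) ℚ.+ frac (ρ v) n)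
             (sym (cnt-blowUp k G v))
             (∣a-[qc+ρ]/n∣≤∣a-c/h∣+rc/hn+ρ/n {q = q} {r = r} n≡qh+r (a v) (c v) (ρ v)))

  dist1ʸ-blowUp-≤ : dist1ʸ H ℚ.≤ dist1ʸ H₀ ℚ.+ frac τ n
  dist1ʸ-blowUp-≤ = begin
    dist1ʸ H                               ≡⟨ dist1ʸ-unmatched H ⟩
    frac (∑[ j < n ] ⟦ unmatched H j ⟧) n  ≡⟨ cong (λ m → frac m n) (unmatched-blowUp k G) ⟩
    frac (q ℕ.* t₀ ℕ.+ τ) n                ≡⟨ frac-+-same (q ℕ.* t₀) τ n′ ⟨
    frac (q ℕ.* t₀) n ℚ.+ frac τ n         ≤⟨ ℚP.+-monoˡ-≤ (frac τ n) (frac-≤ (q ℕ.* t₀) t₀ n′ h′ q-copies-fit) ⟩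
    frac t₀ h ℚ.+ frac τ n                 ≡⟨ cong (ℚ._+ frac τ n) (dist1ʸ-unmatched H₀) ⟨
    dist1ʸ H₀ ℚ.+ frac τ n                 ∎
    where
    open ℚP.≤-Reasoning
    t₀ : ℕ
    t₀ = ∑[ y < h ] ⟦ unmatched H₀ y ⟧
    rearrange : ∀ q t h → t ℕ.* (q ℕ.* h) ≡ q ℕ.* t ℕ.* h
    rearrange = solve-∀
    q-copies-fit : q ℕ.* t₀ ℕ.* h ≤ t₀ ℕ.* n
    q-copies-fit = subst (_≤ t₀ ℕ.* n) (rearrange q t₀ h) (ℕP.*-monoʳ-≤ t₀ (m/n*n≤m n h))

  dist1-blowUp-≤ : dist1 k G H ℚ.≤ dist1 k G H₀ ℚ.+ frac (r ℕ.+ r) n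
  dist1-blowUp-≤ = begin
    dist1ᴳ H ℚ.+ dist1ʸ H
      ≤⟨ ℚP.+-mono-≤ dist1ᴳ-blowUp-≤ dist1ʸ-blowUp-≤ ⟩
    (dist1ᴳ H₀ ℚ.+ frac r n ℚ.+ frac Σρ n) ℚ.+ (dist1ʸ H₀ ℚ.+ frac τ n)
      ≡⟨ solve 5 (λ a b c d e → (a :+ b :+ c) :+ (d :+ e) := (a :+ d) :+ (b :+ (c :+ e))) refl
               (dist1ᴳ H₀) (frac r n) (frac Σρ n) (dist1ʸ H₀) (frac τ n) ⟩
    dist1 k G H₀ ℚ.+ (frac r n ℚ.+ (frac Σρ n ℚ.+ frac τ n))
      ≡⟨ cong (λ x → dist1 k G H₀ ℚ.+ (frac r n ℚ.+ x)) (frac-+-same Σρ τ n′) ⟩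
    dist1 k G H₀ ℚ.+ (frac r n ℚ.+ frac (Σρ ℕ.+ τ) n)
      ≡⟨ cong (dist1 k G H₀ ℚ.+_) (frac-+-same r (Σρ ℕ.+ τ) n′) ⟩
    dist1 k G H₀ ℚ.+ frac (r ℕ.+ (Σρ ℕ.+ τ)) n
      ≤⟨ ℚP.+-monoʳ-≤ (dist1 k G H₀)
           (frac-≤ (r ℕ.+ (Σρ ℕ.+ τ)) (r ℕ.+ r) n′ n′ (ℕP.*-monoˡ-≤ n (ℕP.+-monoʳ-≤ r leftover-classes-≤))) ⟩
    dist1 k G H₀ ℚ.+ frac (r ℕ.+ r) n ∎
    where open ℚP.≤-Reasoning

twice-remainder-≤ : ∀ {r M n′} (δ : ℚ) → r ≤ M → frac (20 ℕ.* M) 1 ℚ.≤ frac (suc n′) 1 ℚ.* δ →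
  frac (r ℕ.+ r) (suc n′) ℚ.≤ frac 1 10 ℚ.* δ
twice-remainder-≤ {r} {M} {n′} δ r≤M 20M≤nδ = begin
  frac (r ℕ.+ r) n                                    ≤⟨ frac-≤ (r ℕ.+ r) (2 ℕ.* M) n′ n′ (ℕP.*-monoˡ-≤ n r+r≤2M) ⟩
  frac (2 ℕ.* M) n                                    ≡⟨ 2M/n≡ ⟩
  frac 1 10 ℚ.* (frac (20 ℕ.* M) 1 ℚ.* frac 1 n)      ≤⟨ ℚP.*-monoˡ-≤-nonNeg (frac 1 10) {{ℚ.nonNegative (frac-nonneg 1 10)}}
                                                          (ℚP.*-monoʳ-≤-nonNeg (frac 1 n) {{ℚ.nonNegative (frac-nonneg 1 n)}} 20M≤nδ) ⟩
  frac 1 10 ℚ.* (frac n 1 ℚ.* δ ℚ.* frac 1 n)         ≡⟨ cong (frac 1 10 ℚ.*_) nδ/n≡δ ⟩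
  frac 1 10 ℚ.* δ                                     ∎
  where
  open ℚP.≤-Reasoning
  n = suc n′
  r+r≤2M : r ℕ.+ r ≤ 2 ℕ.* M
  r+r≤2M = subst (r ℕ.+ r ≤_) (cong (M ℕ.+_) (sym (ℕP.+-identityʳ M))) (ℕP.+-mono-≤ r≤M r≤M)
  2M/n≡ : frac (2 ℕ.* M) n ≡ frac 1 10 ℚ.* (frac (20 ℕ.* M) 1 ℚ.* frac 1 n)
  2M/n≡ = sym (trans (cong (frac 1 10 ℚ.*_) (frac-* (20 ℕ.* M) 1 0 n′))
                (trans (frac-* 1 (20 ℕ.* M ℕ.* 1) 9 (n′ ℕ.+ 0 ℕ.* n))
                       (frac-≡ (1 ℕ.* (20 ℕ.* M ℕ.* 1)) (2 ℕ.* M) ((n′ ℕ.+ 0 ℕ.* n) ℕ.+ 9 ℕ.* suc (n′ ℕ.+ 0 ℕ.* n)) n′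
                               (arith M n))))
    where
    arith : ∀ M n → 1 ℕ.* (20 ℕ.* M ℕ.* 1) ℕ.* n ≡ 2 ℕ.* M ℕ.* (10 ℕ.* (1 ℕ.* n))
    arith = solve-∀
  n·1/n≡1 : frac n 1 ℚ.* frac 1 n ≡ 1ℚ
  n·1/n≡1 = trans (frac-* n 1 0 n′) (frac-≡ (n ℕ.* 1) 1 (n′ ℕ.+ 0 ℕ.* n) 0 (arith n))
    where
    arith : ∀ n → n ℕ.* 1 ℕ.* 1 ≡ 1 ℕ.* (1 ℕ.* n)
    arith = solve-∀
  nδ/n≡δ : frac n 1 ℚ.* δ ℚ.* frac 1 n ≡ δ
  nδ/n≡δ = trans (solve 3 (λ a d b → a :* d :* b := d :* (a :* b)) refl (frac n 1) δ (frac 1 n))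
                 (trans (cong (δ ℚ.*_) n·1/n≡1) (ℚP.*-identityʳ δ))

lemma2p9 : (d : ℕ) (M : ℚ → ℕ → ℕ) → AlonBound d M →
    (δ : ℚ) → 0ℚ < δ → (k : ℕ) → 1 ≤ d → 1 ≤ k →
    (n : ℕ) → (+ (20 ℕ.* M δ k)) / 1 ℚ.≤ ((+ n) / 1) * δ →
    (G : Graph n) → IsSimple G → Bounded d G →
    (h : ℕ) (H₀ : Graph h) → 1 ≤ h → h ≤ M δ k → IsPreserver d δ k G H₀ →
    dist1 k G (blowUp n h H₀) < ((+ 11) / 10) * δ
lemma2p9 d M _ δ _ k _ _ n 20M≤nδ G _ _ zero H₀ () h≤M _
lemma2p9 d M _ δ _ k _ _ zero 20M≤nδ G _ _ (suc h′) H₀ _ h≤M _ =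
  ⊥-elim (ℚP.<-irrefl refl (ℚP.<-≤-trans 0<20M (ℚP.≤-trans 20M≤nδ (ℚP.≤-reflexive (ℚP.*-zeroˡ δ)))))
  where
  0<20M : 0ℚ < frac (20 ℕ.* M δ k) 1
  0<20M = frac-< 0 (20 ℕ.* M δ k) 0 0 (ℕP.≤-trans (s≤s z≤n) (ℕP.≤-trans h≤M
            (ℕP.≤-trans (ℕP.m≤n*m (M δ k) 20) (ℕP.≤-reflexive (sym (ℕP.*-identityʳ _))))))
lemma2p9 d M _ δ _ k _ _ (suc n′) 20M≤nδ G _ _ (suc h′) H₀ _ h≤M (_ , _ , dist<δ) = begin-strict
  dist1 k G H                               ≤⟨ dist1-blowUp-≤ ⟩
  dist1 k G H₀ ℚ.+ frac (r ℕ.+ r) (suc n′)  <⟨ ℚP.+-mono-<-≤ dist<δ (twice-remainder-≤ δ r≤M 20M≤nδ) ⟩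
  δ ℚ.+ frac 1 10 ℚ.* δ                     ≡⟨ solve 2 (λ d t → d :+ t :* d := (con 1ℚ :+ t) :* d) refl δ (frac 1 10) ⟩
  (1ℚ ℚ.+ frac 1 10) ℚ.* δ                 ≡⟨ cong (ℚ._* δ) (frac-+ 1 1 0 9) ⟩
  frac 11 10 ℚ.* δ                          ∎
  where
  open BlowUpEstimate k G H₀
  open BlowUp (suc n′) h′ H₀ using (H; r)
  open ℚP.≤-Reasoning
  r≤M : r ≤ M δ k
  r≤M = ℕP.≤-trans (ℕP.<⇒≤ (m%n<n (suc n′) (suc h′))) h≤M
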